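{- Let $G$ be a connected graph such that $\overline{G}$ is connected. Then $\mathrm{h}_m(G\overline{G})= 2$.
   Context: All graphs are finite, simple and undirected. The complementary prism $G\overline{G}$ of a graph $G$ is obtained from the disjoint union of $G$ and its complement $\overline{G}$ by adding the edges of the perfect matching joining each vertex $u$ of $G$ to its copy $\overline{u}$ in $\overline{G}$. A path is monophonic if it is an induced (chordless) path. A set $S$ of vertices of a graph $H$ is monophonic convex if it contains every vertex of every monophonic path between two vertices of $S$. The monophonic convex hull $[S]_H$ of $S\subseteq V(H)$ is the smallest monophonic convex set of $H$ containing $S$. A set $S$ is an $m$-hull set of $H$ if $[S]_H=V(H)$; the monophonic hull number $\mathrm{h}_m(H)$ is the minimum cardinality of an $m$-hull set of $H$. -}

module Defs where

open import Data.Nat using (ℕ; suc; _<_; _≥_)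
open import Data.Bool using (Bool; true; false; not; _∧_)
open import Data.Fin using (Fin; toℕ; splitAt; _≟_)
open import Data.Fin.Subset using (Subset; _∈_; _⊆_; ∣_∣)
open import Data.Sum using (_⊎_; inj₁; inj₂)
open import Data.Product using (Σ; ∃; _×_)
open import Data.List using (List; length; lookup; head; last)
open import Data.List.Relation.Unary.All using (All)
open import Data.List.Relation.Unary.Unique.Propositional using (Unique)
open import Data.Maybe using (just)
open import Relation.Binary.PropositionalEquality using (_≡_)
open import Relation.Nullary.Decidable using (⌊_⌋)

Adj : ℕ → Set
Adj n = Fin n → Fin n → Bool

IsSimple : ∀ {n} → Adj n → Set
IsSimple {n} G = (∀ (u v : Fin n) → G u v ≡ G v u) × (∀ (u : Fin n) → G u u ≡ false)

compl : ∀ {n} → Adj n → Adj n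
compl G u v = not (G u v) ∧ not ⌊ u ≟ v ⌋

-- Complementary prism G Ḡ on Fin (n + n): the first copy (splitAt gives inj₁ u)
-- is the vertex u of G, the second copy (inj₂ u) is ū in Ḡ.
prismAdj : ∀ {n} → Adj n → Fin n ⊎ Fin n → Fin n ⊎ Fin n → Bool
prismAdj G (inj₁ u) (inj₁ v) = G u v
prismAdj G (inj₂ u) (inj₂ v) = compl G u v
prismAdj G (inj₁ u) (inj₂ v) = ⌊ u ≟ v ⌋
prismAdj G (inj₂ u) (inj₁ v) = ⌊ u ≟ v ⌋

prism : ∀ {n} → Adj n → Adj (n Data.Nat.+ n)
prism {n} G x y = prismAdj G (splitAt n x) (splitAt n y)

data Reach {n} (G : Adj n) : Fin n → Fin n → Set where
  here : ∀ {u} → Reach G u u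
  step : ∀ {u v w} → G u v ≡ true → Reach G v w → Reach G u w

Connected : ∀ {n} → Adj n → Set
Connected {n} G = (n ≥ 1) × (∀ (u v : Fin n) → Reach G u v)

IsMonophonic : ∀ {n} → Adj n → List (Fin n) → Set
IsMonophonic G xs =
  Unique xs
  × (∀ (i j : Fin (length xs)) → toℕ j ≡ suc (toℕ i) → G (lookup xs i) (lookup xs j) ≡ true)
  × (∀ (i j : Fin (length xs)) → suc (toℕ i) < toℕ j → G (lookup xs i) (lookup xs j) ≡ false)

MonoPath : ∀ {n} → Adj n → Fin n → Fin n → List (Fin n) → Set
MonoPath G a b xs = IsMonophonic G xs × head xs ≡ just a × last xs ≡ just b

MConvex : ∀ {n} → Adj n → Subset n → Set
MConvex {n} G S = ∀ (a b : Fin n) (xs : List (Fin n)) → a ∈ S → b ∈ S → MonoPath G a b xs → All (_∈ S) xs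

InHull : ∀ {n} → Adj n → Subset n → Fin n → Set
InHull {n} G S v = ∀ (T : Subset n) → MConvex G T → S ⊆ T → v ∈ T

IsMHullSet : ∀ {n} → Adj n → Subset n → Set
IsMHullSet {n} G S = ∀ (v : Fin n) → InHull G S v

MHullNumber : ∀ {n} → Adj n → ℕ → Set
MHullNumber {n} G k = (Σ (Subset n) λ S → IsMHullSet G S × ∣ S ∣ ≡ k)
                    × (∀ (S : Subset n) → IsMHullSet G S → k Data.Nat.≤ ∣ S ∣)

{-# OPTIONS --safe #-}
module Submission where

-- Since G and Ḡ are connected, G contains an induced path a – c – b, and we show that
-- {a, b̄} is an m-hull set of GḠ. Call a vertex v full for a convex set T if both v and v̄
-- lie in T. The induced paths a, ā, b̄ and a, c, b, b̄ make a and b full. A non-full vertex y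
-- must then be adjacent in G either to every full vertex or to none: otherwise, for a full
-- neighbour f and a full non-neighbour g, the induced path ḡ, ȳ, y, f makes y full.
-- Following a walk in G from a, the first vertex outside "full or adjacent to a" would be
-- made full by such a path, so every non-full vertex is adjacent to a; following a walk in Ḡ
-- from a, the first non-full vertex then has both a full neighbour and a full non-neighbour.
-- Hence every vertex is full. Conversely no single vertex generates GḠ, as one-element sets
-- are convex.

open import Defs
open import Data.Nat using (ℕ; zero; suc; pred; _+_; _≤_; _<_; s≤s)
open import Data.Nat.Properties using (_≤?_)
open import Data.Bool using (true; false; not) renaming (_≟_ to _≟ᵇ_)
open import Data.Bool.Properties using (¬-not)
open import Data.Fin using (Fin; zero; suc; toℕ; splitAt; join; _≟_)
open import Data.Fin.Properties using (splitAt-join; join-splitAt)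
open import Data.Fin.Subset using (Subset; _∈_; _⊆_; ∣_∣; ⁅_⁆; _∪_; ⊤)
open import Data.Fin.Subset.Properties
  using (_∈?_; ∈⊤; ∣⊤∣≡n; x∈⁅x⁆; x∈⁅y⁆⇒x≡y; x∈p∪q⁺; x∈p∪q⁻; ∣⁅x⁆∣≡1; ∪-identityˡ; ∪-identityʳ; p⊆q⇒∣p∣≤∣q∣)
open import Data.Sum using (_⊎_; inj₁; inj₂)
open import Data.Product using (Σ; ∃₂; _×_; _,_; proj₁; proj₂)
open import Data.List using ([]; _∷_; lookup; last)
open import Data.List.Relation.Unary.All as All using (All; []; _∷_)
open import Data.List.Relation.Unary.AllPairs using ([]; _∷_)
open import Data.List.Membership.Propositional.Properties using (∈-lookup)
open import Data.Maybe using (just)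
open import Data.Empty using (⊥; ⊥-elim)
open import Relation.Nullary using (¬_; Dec; yes; no; contradiction)
open import Relation.Nullary.Decidable using (⌊_⌋; isYes≗does; dec-true; dec-false; _×-dec_; _⊎-dec_)
open import Relation.Unary using (Pred; Decidable)
open import Relation.Binary.PropositionalEquality using (_≡_; _≢_; refl; sym; trans; cong; subst; ≢-sym)

⌊⌋-true : ∀ {a} {A : Set a} (a? : Dec A) → A → ⌊ a? ⌋ ≡ true
⌊⌋-true a? a = trans (isYes≗does a?) (dec-true a? a)

⌊⌋-false : ∀ {a} {A : Set a} (a? : Dec A) → ¬ A → ⌊ a? ⌋ ≡ false
⌊⌋-false a? ¬a = trans (isYes≗does a?) (dec-false a? ¬a)

Reach-crossing : ∀ {n p} {H : Adj n} {P : Pred (Fin n) p} → Decidable P →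
                 ∀ {s t} → Reach H s t → P s → ¬ P t →
                 ∃₂ λ p q → H p q ≡ true × P p × ¬ P q
Reach-crossing P? here Ps ¬Pt = contradiction Ps ¬Pt
Reach-crossing P? (step {u} {v} Huv v⇝t) Pu ¬Pt with P? v
... | yes Pv = Reach-crossing P? v⇝t Pv ¬Pt
... | no ¬Pv = u , v , Huv , Pu , ¬Pv

module MonophonicPaths {N : ℕ} (H : Adj N) where

  IsMonophonic-[_] : ∀ x → IsMonophonic H (x ∷ [])
  IsMonophonic-[ x ] = [] ∷ [] , consecutive , nonconsecutive
    where
    consecutive : ∀ (i j : Fin 1) → toℕ j ≡ suc (toℕ i) → H (lookup (x ∷ []) i) (lookup (x ∷ []) j) ≡ true
    consecutive zero zero ()
    nonconsecutive : ∀ (i j : Fin 1) → suc (toℕ i) < toℕ j → H (lookup (x ∷ []) i) (lookup (x ∷ []) j) ≡ false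
    nonconsecutive zero zero ()

  IsMonophonic-∷ : ∀ {x y ys} → H x y ≡ true → All (λ z → H x z ≡ false) ys →
                   All (x ≢_) (y ∷ ys) → IsMonophonic H (y ∷ ys) → IsMonophonic H (x ∷ y ∷ ys)
  IsMonophonic-∷ {x} {y} {ys} Hxy nonadjacent distinct (unique , consecutive , nonconsecutive) =
    distinct ∷ unique , consecutive′ , nonconsecutive′
    where
    consecutive′ : ∀ i j → toℕ j ≡ suc (toℕ i) → H (lookup (x ∷ y ∷ ys) i) (lookup (x ∷ y ∷ ys) j) ≡ true
    consecutive′ zero    (suc zero)    _ = Hxy
    consecutive′ (suc i) (suc j)       e = consecutive i j (cong pred e)
    consecutive′ zero    zero          ()
    consecutive′ zero    (suc (suc _)) ()
    consecutive′ (suc _) zero          ()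
    nonconsecutive′ : ∀ i j → suc (toℕ i) < toℕ j → H (lookup (x ∷ y ∷ ys) i) (lookup (x ∷ y ∷ ys) j) ≡ false
    nonconsecutive′ zero    (suc (suc j)) _           = All.lookup nonadjacent (∈-lookup j)
    nonconsecutive′ (suc i) (suc j)       (s≤s i<j) = nonconsecutive i j i<j
    nonconsecutive′ zero    (suc zero)    (s≤s ())

  IsMonophonic-edge : ∀ {x y} → H x y ≡ true → x ≢ y → IsMonophonic H (x ∷ y ∷ [])
  IsMonophonic-edge Hxy x≢y = IsMonophonic-∷ Hxy [] (x≢y ∷ []) IsMonophonic-[ _ ]

  last-distinct : ∀ {a : Fin N} y ys → All (a ≢_) (y ∷ ys) → last (y ∷ ys) ≢ just a
  last-distinct y []       (a≢y ∷ []) refl = a≢y refl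
  last-distinct y (z ∷ zs) (_ ∷ a≢zs) eq   = last-distinct z zs a≢zs eq

  MonoPath-closed : ∀ {a xs} → MonoPath H a a xs → xs ≡ a ∷ []
  MonoPath-closed {xs = x ∷ []}     (_ , refl , _) = refl
  MonoPath-closed {xs = x ∷ y ∷ ys} ((a≢ ∷ _ , _) , refl , ends) = contradiction ends (last-distinct y ys a≢)

  MConvex-subsingleton : ∀ {S : Subset N} → (∀ {a b} → a ∈ S → b ∈ S → a ≡ b) → MConvex H S
  MConvex-subsingleton S≤1 a b xs a∈S b∈S path rewrite S≤1 b∈S a∈S | MonoPath-closed path = a∈S ∷ []

  module _ {T : Subset N} (convex : MConvex H T) where

    MConvex-P₃ : ∀ {x y z} → x ∈ T → z ∈ T → IsMonophonic H (x ∷ y ∷ z ∷ []) → y ∈ T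
    MConvex-P₃ x∈T z∈T path with convex _ _ _ x∈T z∈T (path , refl , refl)
    ... | _ ∷ y∈T ∷ _ = y∈T

    MConvex-P₄ : ∀ {x y z w} → x ∈ T → w ∈ T → IsMonophonic H (x ∷ y ∷ z ∷ w ∷ []) → y ∈ T × z ∈ T
    MConvex-P₄ x∈T w∈T path with convex _ _ _ x∈T w∈T (path , refl , refl)
    ... | _ ∷ y∈T ∷ z∈T ∷ _ = y∈T , z∈T

∣⁅x⁆∪⁅y⁆∣≡2 : ∀ {N} {x y : Fin N} → x ≢ y → ∣ ⁅ x ⁆ ∪ ⁅ y ⁆ ∣ ≡ 2
∣⁅x⁆∪⁅y⁆∣≡2 {x = zero}  {zero}  x≢y = contradiction refl x≢y
∣⁅x⁆∪⁅y⁆∣≡2 {x = zero}  {suc y} _   rewrite ∪-identityˡ ⁅ y ⁆ | ∣⁅x⁆∣≡1 y = refl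
∣⁅x⁆∪⁅y⁆∣≡2 {x = suc x} {zero}  _   rewrite ∪-identityʳ ⁅ x ⁆ | ∣⁅x⁆∣≡1 x = refl
∣⁅x⁆∪⁅y⁆∣≡2 {x = suc x} {suc y} x≢y = ∣⁅x⁆∪⁅y⁆∣≡2 (λ x≡y → x≢y (cong suc x≡y))

2≤∣p∣ : ∀ {N} {p : Subset N} {x y} → x ≢ y → x ∈ p → y ∈ p → 2 ≤ ∣ p ∣
2≤∣p∣ {p = p} {x} {y} x≢y x∈p y∈p = subst (_≤ ∣ p ∣) (∣⁅x⁆∪⁅y⁆∣≡2 x≢y) (p⊆q⇒∣p∣≤∣q∣ pair⊆p)
  where
  pair⊆p : ⁅ x ⁆ ∪ ⁅ y ⁆ ⊆ p
  pair⊆p z∈ with x∈p∪q⁻ ⁅ x ⁆ ⁅ y ⁆ z∈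
  ... | inj₁ z∈⁅x⁆ = subst (_∈ p) (sym (x∈⁅y⁆⇒x≡y x z∈⁅x⁆)) x∈p
  ... | inj₂ z∈⁅y⁆ = subst (_∈ p) (sym (x∈⁅y⁆⇒x≡y y z∈⁅y⁆)) y∈p

module _ {n : ℕ} where

  ι₁ ι₂ : Fin n → Fin (n + n)
  ι₁ x = join n n (inj₁ x)
  ι₂ x = join n n (inj₂ x)

  join-injective : ∀ {x y} → join n n x ≡ join n n y → x ≡ y
  join-injective {x} {y} eq = trans (sym (splitAt-join n n x)) (trans (cong (splitAt n) eq) (splitAt-join n n y))

  ι₁≢ι₂ : ∀ {x y} → ι₁ x ≢ ι₂ y
  ι₁≢ι₂ eq with join-injective {inj₁ _} {inj₂ _} eq
  ... | ()

  ι₂≢ι₁ : ∀ {x y} → ι₂ x ≢ ι₁ y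
  ι₂≢ι₁ eq = ι₁≢ι₂ (sym eq)

  ι₁-≢ : ∀ {x y} → x ≢ y → ι₁ x ≢ ι₁ y
  ι₁-≢ x≢y eq with join-injective {inj₁ _} {inj₁ _} eq
  ... | refl = x≢y refl

  ι₂-≢ : ∀ {x y} → x ≢ y → ι₂ x ≢ ι₂ y
  ι₂-≢ x≢y eq with join-injective {inj₂ _} {inj₂ _} eq
  ... | refl = x≢y refl

module _ {n : ℕ} (G : Adj n) where

  prism-join : ∀ x y → prism G (join n n x) (join n n y) ≡ prismAdj G x y
  prism-join x y rewrite splitAt-join n n x | splitAt-join n n y = refl

  prism-ι₁ι₁ : ∀ x y → prism G (ι₁ x) (ι₁ y) ≡ G x y
  prism-ι₁ι₁ x y = prism-join (inj₁ x) (inj₁ y)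

  prism-ι₂ι₂ : ∀ {x y} → G x y ≡ false → x ≢ y → prism G (ι₂ x) (ι₂ y) ≡ true
  prism-ι₂ι₂ {x} {y} Gxy x≢y rewrite prism-join (inj₂ x) (inj₂ y) | Gxy | ⌊⌋-false (x ≟ y) x≢y = refl

  prism-ι₁ι₂ : ∀ x → prism G (ι₁ x) (ι₂ x) ≡ true
  prism-ι₁ι₂ x = trans (prism-join (inj₁ x) (inj₂ x)) (⌊⌋-true (x ≟ x) refl)

  prism-ι₂ι₁ : ∀ x → prism G (ι₂ x) (ι₁ x) ≡ true
  prism-ι₂ι₁ x = trans (prism-join (inj₂ x) (inj₁ x)) (⌊⌋-true (x ≟ x) refl)

  prism-ι₁ι₂-≢ : ∀ {x y} → x ≢ y → prism G (ι₁ x) (ι₂ y) ≡ false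
  prism-ι₁ι₂-≢ {x} {y} x≢y = trans (prism-join (inj₁ x) (inj₂ y)) (⌊⌋-false (x ≟ y) x≢y)

  prism-ι₂ι₁-≢ : ∀ {x y} → x ≢ y → prism G (ι₂ x) (ι₁ y) ≡ false
  prism-ι₂ι₁-≢ {x} {y} x≢y = trans (prism-join (inj₂ x) (inj₁ y)) (⌊⌋-false (x ≟ y) x≢y)

  compl-true⇒false : ∀ {x y} → compl G x y ≡ true → G x y ≡ false
  compl-true⇒false {x} {y} eq with G x y
  ... | false = refl
  ... | true  = contradiction eq λ ()

  compl-true⇒≢ : ∀ {x y} → compl G x y ≡ true → x ≢ y
  compl-true⇒≢ {x} eq refl with G x x
  ... | false = contradiction (trans (sym eq) (cong not (⌊⌋-true (x ≟ x) refl))) λ ()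
  ... | true  = contradiction eq λ ()

module Closure {n : ℕ} {G : Adj n} (simple : IsSimple G)
               {T : Subset (n + n)} (convex : MConvex (prism G) T) where

  open MonophonicPaths (prism G)

  private
    G-sym : ∀ x y → G x y ≡ G y x
    G-sym = proj₁ simple

    adjacent⇒≢ : ∀ {x y} → G x y ≡ true → x ≢ y
    adjacent⇒≢ {x} Gxy refl = contradiction (trans (sym Gxy) (proj₂ simple x)) λ ()

  Full : Fin n → Set
  Full x = ι₁ x ∈ T × ι₂ x ∈ T

  Full? : Decidable Full
  Full? x = (ι₁ x ∈? T) ×-dec (ι₂ x ∈? T)

  all-Full⇒∈ : (∀ x → Full x) → ∀ v → v ∈ T
  all-Full⇒∈ full v = subst (_∈ T) (join-splitAt n n v) (join-∈ (splitAt n v))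
    where
    join-∈ : ∀ s → join n n s ∈ T
    join-∈ (inj₁ x) = proj₁ (full x)
    join-∈ (inj₂ x) = proj₂ (full x)

  ι₂-∈-nonadjacent : ∀ {x y} → ι₁ x ∈ T → ι₂ y ∈ T → x ≢ y → G x y ≡ false → ι₂ x ∈ T
  ι₂-∈-nonadjacent x∈T ȳ∈T x≢y Gxy = MConvex-P₃ convex x∈T ȳ∈T
    (IsMonophonic-∷ (prism-ι₁ι₂ G _) (prism-ι₁ι₂-≢ G x≢y ∷ []) (ι₁≢ι₂ ∷ ι₁≢ι₂ ∷ [])
      (IsMonophonic-edge (prism-ι₂ι₂ G Gxy x≢y) (ι₂-≢ x≢y)))

  ι₁-∈-common-neighbour : ∀ {x y z} → ι₁ x ∈ T → ι₁ z ∈ T → x ≢ z →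
                          G x y ≡ true → G y z ≡ true → G x z ≡ false → ι₁ y ∈ T
  ι₁-∈-common-neighbour {x} {y} {z} x∈T z∈T x≢z Gxy Gyz Gxz = MConvex-P₃ convex x∈T z∈T
    (IsMonophonic-∷ (trans (prism-ι₁ι₁ G x y) Gxy) (trans (prism-ι₁ι₁ G x z) Gxz ∷ [])
      (ι₁-≢ (adjacent⇒≢ Gxy) ∷ ι₁-≢ x≢z ∷ [])
      (IsMonophonic-edge (trans (prism-ι₁ι₁ G y z) Gyz) (ι₁-≢ (adjacent⇒≢ Gyz))))

  ι₁-∈-P₃-end : ∀ {x y z} → ι₁ x ∈ T → ι₂ z ∈ T → x ≢ z →
                G x y ≡ true → G y z ≡ true → G x z ≡ false → ι₁ z ∈ T
  ι₁-∈-P₃-end {x} {y} {z} x∈T z̄∈T x≢z Gxy Gyz Gxz = proj₂ (MConvex-P₄ convex x∈T z̄∈T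
    (IsMonophonic-∷ (trans (prism-ι₁ι₁ G x y) Gxy)
        (trans (prism-ι₁ι₁ G x z) Gxz ∷ prism-ι₁ι₂-≢ G x≢z ∷ [])
        (ι₁-≢ (adjacent⇒≢ Gxy) ∷ ι₁-≢ x≢z ∷ ι₁≢ι₂ ∷ [])
      (IsMonophonic-∷ (trans (prism-ι₁ι₁ G y z) Gyz) (prism-ι₁ι₂-≢ G (adjacent⇒≢ Gyz) ∷ [])
          (ι₁-≢ (adjacent⇒≢ Gyz) ∷ ι₁≢ι₂ ∷ [])
        (IsMonophonic-edge (prism-ι₁ι₂ G z) (ι₁≢ι₂)))))

  Full-between : ∀ {x y z} → ι₁ x ∈ T → ι₂ z ∈ T → x ≢ z →
                 G x y ≡ true → G y z ≡ false → y ≢ z → Full y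
  Full-between {x} {y} {z} x∈T z̄∈T x≢z Gxy Gyz y≢z
    with MConvex-P₄ convex z̄∈T x∈T
      (IsMonophonic-∷ (prism-ι₂ι₂ G (trans (G-sym z y) Gyz) (≢-sym y≢z))
          (prism-ι₂ι₁-≢ G (≢-sym y≢z) ∷ prism-ι₂ι₁-≢ G (≢-sym x≢z) ∷ [])
          (ι₂-≢ (≢-sym y≢z) ∷ ι₂≢ι₁ ∷ ι₂≢ι₁ ∷ [])
        (IsMonophonic-∷ (prism-ι₂ι₁ G y) (prism-ι₂ι₁-≢ G (≢-sym (adjacent⇒≢ Gxy)) ∷ [])
            (ι₂≢ι₁ ∷ ι₂≢ι₁ ∷ [])
          (IsMonophonic-edge (trans (prism-ι₁ι₁ G y x) (trans (G-sym y x) Gxy))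
            (ι₁-≢ (≢-sym (adjacent⇒≢ Gxy))))))
  ... | ȳ∈T , y∈T = y∈T , ȳ∈T

  nonFull-homogeneous : ∀ {f g y} → Full f → Full g → ¬ Full y → G f y ≡ true → G g y ≡ false → ⊥
  nonFull-homogeneous {f} {g} {y} (f∈T , _) full-g@(_ , ḡ∈T) ¬full-y Gfy Ggy =
    ¬full-y (Full-between f∈T ḡ∈T f≢g Gfy (trans (G-sym y g) Ggy) y≢g)
    where
    f≢g : f ≢ g
    f≢g refl = contradiction (trans (sym Gfy) Ggy) λ ()
    y≢g : y ≢ g
    y≢g refl = ¬full-y full-g

  module _ {a b : Fin n} (a≢b : a ≢ b) (Gab : G a b ≡ false) (full-a : Full a) (full-b : Full b) where

    ι₁-∈-neighbour : ∀ {y} → G a y ≡ true → ι₁ y ∈ T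
    ι₁-∈-neighbour {y} Gay with Full? y | G b y ≟ᵇ true
    ... | yes full-y | _      = proj₁ full-y
    ... | no _       | yes Gby = ι₁-∈-common-neighbour (proj₁ full-a) (proj₁ full-b) a≢b Gay (trans (G-sym y b) Gby) Gab
    ... | no ¬full-y | no Gby≢ = ⊥-elim (nonFull-homogeneous full-a full-b ¬full-y Gay (¬-not Gby≢))

    nonFull⇒adjacent : Connected G → ∀ {w} → ¬ Full w → G a w ≡ true
    nonFull⇒adjacent (_ , reach) {w} ¬full-w with G a w ≟ᵇ true
    ... | yes Gaw = Gaw
    ... | no Gaw≢
      with Reach-crossing P? (reach a w) (inj₁ full-a) (λ { (inj₁ full-w) → ¬full-w full-w ; (inj₂ Gaw) → Gaw≢ Gaw })
      where
      P? : Decidable (λ y → Full y ⊎ G a y ≡ true)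
      P? y = Full? y ⊎-dec (G a y ≟ᵇ true)
    ... | p , q , Gpq , Pp , ¬Pq = ⊥-elim (crossing Pp)
      where
      ¬full-q : ¬ Full q
      ¬full-q full-q = ¬Pq (inj₁ full-q)
      Gaq : G a q ≡ false
      Gaq = ¬-not λ Gaq → ¬Pq (inj₂ Gaq)
      crossing : Full p ⊎ G a p ≡ true → ⊥
      crossing (inj₁ full-p) = nonFull-homogeneous full-p full-a ¬full-q Gpq Gaq
      crossing (inj₂ Gap) = ¬full-q
        (Full-between (ι₁-∈-neighbour Gap) (proj₂ full-a) (≢-sym (adjacent⇒≢ Gap)) Gpq
          (trans (G-sym q a) Gaq) λ { refl → ¬full-q full-a })

    all-Full : Connected G → Connected (compl G) → ∀ v → Full v
    all-Full connected (_ , reach) v with Full? v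
    ... | yes full-v = full-v
    ... | no ¬full-v with Reach-crossing Full? (reach a v) full-a ¬full-v
    ... | p , q , Ḡpq , full-p , ¬full-q =
      ⊥-elim (nonFull-homogeneous full-a full-p ¬full-q (nonFull⇒adjacent connected ¬full-q) (compl-true⇒false G Ḡpq))

induced-P₃ : ∀ {m} (G : Adj (suc (suc m))) → Connected G → Connected (compl G) →
             Σ (Fin (suc (suc m))) λ a → Σ _ λ c → Σ _ λ b → G a c ≡ true × G c b ≡ true × G a b ≡ false × a ≢ b
induced-P₃ G (_ , reach) (_ , reachᶜ)
  with Reach-crossing (_≟ zero) (reachᶜ zero (suc zero)) refl (λ ())
... | u , w , Ḡuw , _ , _
  with Reach-crossing P? (reach u w) (inj₁ refl)
         (λ { (inj₁ w≡u) → compl-true⇒≢ G Ḡuw (sym w≡u)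
            ; (inj₂ Guw) → contradiction (trans (sym Guw) (compl-true⇒false G Ḡuw)) λ () })
  where
  P? : Decidable (λ y → y ≡ u ⊎ G u y ≡ true)
  P? y = (y ≟ u) ⊎-dec (G u y ≟ᵇ true)
... | p , q , Gpq , inj₁ refl , ¬Pq = contradiction (inj₂ Gpq) ¬Pq
... | p , q , Gpq , inj₂ Gup , ¬Pq = u , p , q , Gup , Gpq , ¬-not (λ Guq → ¬Pq (inj₂ Guq)) , λ { refl → ¬Pq (inj₁ refl) }

IsMHullSet-size : ∀ {N} (H : Adj N) {S : Subset N} {x y : Fin N} → x ≢ y → IsMHullSet H S → 2 ≤ ∣ S ∣
IsMHullSet-size H {S} {x} {y} x≢y hull with 2 ≤? ∣ S ∣
... | yes 2≤∣S∣ = 2≤∣S∣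
... | no 2≰∣S∣ = contradiction (2≤∣p∣ x≢y (∈S x) (∈S y)) 2≰∣S∣
  where
  subsingleton : ∀ {a b} → a ∈ S → b ∈ S → a ≡ b
  subsingleton {a} {b} a∈S b∈S with a ≟ b
  ... | yes a≡b = a≡b
  ... | no a≢b  = contradiction (2≤∣p∣ a≢b a∈S b∈S) 2≰∣S∣
  ∈S : ∀ v → v ∈ S
  ∈S v = hull v S (MonophonicPaths.MConvex-subsingleton H subsingleton) (λ v∈S → v∈S)

IsMHullSet-P₃-ends : ∀ {n} {G : Adj n} {a c b} → IsSimple G → Connected G → Connected (compl G) →
                     G a c ≡ true → G c b ≡ true → G a b ≡ false → a ≢ b →
                     IsMHullSet (prism G) (⁅ ι₁ a ⁆ ∪ ⁅ ι₂ b ⁆)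
IsMHullSet-P₃-ends {G = G} {a} {c} {b} simple connected connectedᶜ Gac Gcb Gab a≢b v T convex S⊆T =
  all-Full⇒∈ (all-Full a≢b Gab full-a full-b connected connectedᶜ) v
  where
  open Closure simple convex
  a∈T : ι₁ a ∈ T
  a∈T = S⊆T (x∈p∪q⁺ (inj₁ (x∈⁅x⁆ _)))
  b̄∈T : ι₂ b ∈ T
  b̄∈T = S⊆T (x∈p∪q⁺ (inj₂ (x∈⁅x⁆ _)))
  full-a : Full a
  full-a = a∈T , ι₂-∈-nonadjacent a∈T b̄∈T a≢b Gab
  full-b : Full b
  full-b = ι₁-∈-P₃-end a∈T b̄∈T a≢b Gac Gcb Gab , b̄∈T

theorem5p2 : ∀ (n : ℕ) (G : Adj n) → IsSimple G → Connected G → Connected (compl G)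
             → MHullNumber (prism G) 2
theorem5p2 zero          G _ (() , _) _
theorem5p2 (suc zero)    G _ _ _ =
  (⊤ , (λ v T _ ⊤⊆T → ⊤⊆T ∈⊤) , ∣⊤∣≡n 2) , λ S → IsMHullSet-size (prism G) (ι₁≢ι₂ {1} {zero} {zero})
theorem5p2 (suc (suc m)) G simple connected connectedᶜ with induced-P₃ G connected connectedᶜ
... | a , c , b , Gac , Gcb , Gab , a≢b =
  ( ⁅ ι₁ a ⁆ ∪ ⁅ ι₂ b ⁆
  , IsMHullSet-P₃-ends simple connected connectedᶜ Gac Gcb Gab a≢b
  , ∣⁅x⁆∪⁅y⁆∣≡2 (ι₁≢ι₂ {x = a} {b}))
  , λ S → IsMHullSet-size (prism G) (ι₁≢ι₂ {x = a} {a})
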